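{- Let $\Phi\subseteq\{I,O,Q,U,\mathit{Self}\}$, let $\mathcal{T}$ be a TBox in $\mathcal{L}_\Phi$, and let $\mathcal{I},\mathcal{I}'$ be unreachable-objects-free interpretations (w.r.t. $\mathcal{L}_\Phi$) such that there exists an $\mathcal{L}_\Phi$-bisimulation between $\mathcal{I}$ and $\mathcal{I}'$. Then $\mathcal{I}$ is a model of $\mathcal{T}$ iff $\mathcal{I}'$ is a model of $\mathcal{T}$.
   Context: Fix finite sets $\Sigma_C,\Sigma_R,\Sigma_I$ of concept, role and individual names. Roles/concepts of $\mathcal{L}_\Phi$: $r\in\Sigma_R$ roles, $A\in\Sigma_C$ concepts; closed under role constructors $\varepsilon, R\circ S, R\sqcup S, R^*, C?$ and concept constructors $\top,\bot,\neg C,C\sqcap D,C\sqcup D,\forall R.C,\exists R.C$; plus $R^-$ if $I\in\Phi$; $\{a\}$ ($a\in\Sigma_I$) if $O\in\Phi$; $\geq n\,r.C$, $\leq n\,r.C$ ($r\in\Sigma_R$) if $Q\in\Phi$, and $\geq n\,r^-.C$, $\leq n\,r^-.C$ if $Q,I\in\Phi$; the role $U$ if $U\in\Phi$; $\exists r.\mathit{Self}$ if $\mathit{Self}\in\Phi$. Interpretations are extended in the standard way: composition, union, reflexive-transitive closure, $(C?)^{\mathcal{I}}=\{(x,x):x\in C^{\mathcal{I}}\}$, $\varepsilon^{\mathcal{I}}$ identity, $U^{\mathcal{I}}=(\Delta^{\mathcal{I}})^2$, $(R^-)^{\mathcal{I}}$ inverse, Booleans set-theoretically, $\{a\}^{\mathcal{I}}=\{a^{\mathcal{I}}\}$,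 $(\exists r.\mathit{Self})^{\mathcal{I}}=\{x:(x,x)\in r^{\mathcal{I}}\}$, $\forall,\exists$ as usual, $(\geq n\,R.C)^{\mathcal{I}}=\{x:\#\{y:(x,y)\in R^{\mathcal{I}},y\in C^{\mathcal{I}}\}\ge n\}$, similarly $\le n$. A TBox in $\mathcal{L}_\Phi$ is a finite set of axioms $C\sqsubseteq D$ ($C,D$ concepts of $\mathcal{L}_\Phi$); $\mathcal{I}$ is a model if $C^{\mathcal{I}}\subseteq D^{\mathcal{I}}$ for each. Basic roles: elements of $\Sigma_R\cup\{r^-:r\in\Sigma_R\}$ if $I\in\Phi$, of $\Sigma_R$ otherwise. $\mathcal{I}$ is unreachable-objects-free if every $x\in\Delta^{\mathcal{I}}$ is reachable from some $a^{\mathcal{I}}$, $a\in\Sigma_I$, by a finite path $x_0=a^{\mathcal{I}},\dots,x_k=x$ ($k\ge0$) with $(x_{i-1},x_i)\in R_i^{\mathcal{I}}$ for basic roles $R_i$. $Z\subseteq\Delta^{\mathcal{I}}\times\Delta^{\mathcal{I}'}$ is an $\mathcal{L}_\Phi$-bisimulation if for all $a\in\Sigma_I,A\in\Sigma_C,r\in\Sigma_R$, $x,y\in\Delta^{\mathcal{I}}$, $x',y'\in\Delta^{\mathcal{I}'}$: (B1) $Z(a^{\mathcal{I}},a^{\mathcal{I}'})$; (B2) $Z(x,x')\Rightarrow(x\in A^{\mathcal{I}}\iff x'\in A^{\mathcal{I}'})$; (B3) $Z(x,x')\wedge(x,y)\in r^{\mathcal{I}}\Rightarrow\exists y'(Z(y,y')\wedge(x',y')\in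 r^{\mathcal{I}'})$; (B4) $Z(x,x')\wedge(x',y')\in r^{\mathcal{I}'}\Rightarrow\exists y(Z(y,y')\wedge(x,y)\in r^{\mathcal{I}})$; if $I\in\Phi$: (B5),(B6) analogous conditions for predecessors; if $O\in\Phi$: (B7) $Z(x,x')\Rightarrow(x=a^{\mathcal{I}}\iff x'=a^{\mathcal{I}'})$; if $Q\in\Phi$: (B8) $Z(x,x')$ implies for every $r$ a bijection between $r$-successors of $x$ and of $x'$ contained in $Z$; if $Q,I\in\Phi$ also (B9) the same for $r$-predecessors; if $U\in\Phi$: (B10),(B11) $Z$ is total on $\Delta^{\mathcal{I}}$ and surjective onto $\Delta^{\mathcal{I}'}$; if $\mathit{Self}\in\Phi$: (B12) $Z(x,x')\Rightarrow((x,x)\in r^{\mathcal{I}}\iff(x',x')\in r^{\mathcal{I}'})$. -}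

module Defs where

open import Data.Bool using (Bool; T)
open import Data.Nat using (ℕ; suc)
open import Data.Fin using (Fin)
open import Data.Product using (Σ; ∃; _×_; _,_)
open import Data.Sum using (_⊎_)
open import Data.Unit using (⊤)
open import Data.Empty using (⊥)
open import Data.List using (List)
open import Data.List.Relation.Unary.All using (All)
open import Relation.Nullary using (¬_)
open import Relation.Binary.PropositionalEquality using (_≡_)
open import Relation.Binary.Construct.Closure.ReflexiveTransitive using (Star)
open import Function.Bundles using (_⇔_)

-- The set Φ ⊆ {I, O, Q, U, Self}, given by its characteristic function.
record Features : Set where
  field
    hasI hasO hasQ hasU hasSelf : Bool
open Features public

record Signature : Set where
  field
    nC nR nI : ℕ
  CName = Fin nC
  RName = Fin nR
  IName = Fin nI
open Signature public

record Interp (S : Signature) : Set₁ where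
  field
    Δ    : Set
    conc : CName S → Δ → Set
    role : RName S → Δ → Δ → Set
    ind  : IName S → Δ
open Interp public

module _ (S : Signature) (Φ : Features) where

  data BasicRole : Set where
    bname : RName S → BasicRole
    binv  : T (hasI Φ) → RName S → BasicRole

  mutual
    data Role : Set where
      rname : RName S → Role
      ε     : Role
      _∘ʳ_  : Role → Role → Role
      _⊔ʳ_  : Role → Role → Role
      _*ʳ   : Role → Role
      _¿    : Concept → Role
      _⁻    : {{_ : T (hasI Φ)}} → Role → Role
      U     : {{_ : T (hasU Φ)}} → Role

    data Concept : Set where
      cname  : CName S → Concept
      ⊤ᶜ ⊥ᶜ  : Concept
      ¬ᶜ_    : Concept → Concept
      _⊓_ _⊔_ : Concept → Concept → Concept
      ∀ᶜ ∃ᶜ  : Role → Concept → Concept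
      nominal : {{_ : T (hasO Φ)}} → IName S → Concept
      atLeast atMost : {{_ : T (hasQ Φ)}} → ℕ → BasicRole → Concept → Concept
      selfᶜ  : {{_ : T (hasSelf Φ)}} → RName S → Concept

  -- axioms C ⊑ D
  TBox : Set
  TBox = List (Concept × Concept)

  module _ (𝓘 : Interp S) where
    private D = Δ 𝓘

    ⟦_⟧b : BasicRole → D → D → Set
    ⟦ bname r ⟧b x y = role 𝓘 r x y
    ⟦ binv _ r ⟧b x y = role 𝓘 r y x

    AtLeast : ℕ → (D → D → Set) → (D → Set) → D → Set
    AtLeast n R C x =
      Σ (Fin n → D) λ f → (∀ i j → f i ≡ f j → i ≡ j) × (∀ i → R x (f i) × C (f i))

    mutual
      ⟦_⟧r : Role → D → D → Set
      ⟦ rname r ⟧r x y = role 𝓘 r x y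
      ⟦ ε ⟧r x y = x ≡ y
      ⟦ R ∘ʳ R' ⟧r x y = ∃ λ z → ⟦ R ⟧r x z × ⟦ R' ⟧r z y
      ⟦ R ⊔ʳ R' ⟧r x y = ⟦ R ⟧r x y ⊎ ⟦ R' ⟧r x y
      ⟦ R *ʳ ⟧r x y = Star ⟦ R ⟧r x y
      ⟦ C ¿ ⟧r x y = x ≡ y × ⟦ C ⟧c x
      ⟦ R ⁻ ⟧r x y = ⟦ R ⟧r y x
      ⟦ U ⟧r x y = ⊤

      ⟦_⟧c : Concept → D → Set
      ⟦ cname A ⟧c x = conc 𝓘 A x
      ⟦ ⊤ᶜ ⟧c x = ⊤
      ⟦ ⊥ᶜ ⟧c x = ⊥
      ⟦ ¬ᶜ C ⟧c x = ¬ ⟦ C ⟧c x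
      ⟦ C ⊓ C' ⟧c x = ⟦ C ⟧c x × ⟦ C' ⟧c x
      ⟦ C ⊔ C' ⟧c x = ⟦ C ⟧c x ⊎ ⟦ C' ⟧c x
      ⟦ ∀ᶜ R C ⟧c x = ∀ y → ⟦ R ⟧r x y → ⟦ C ⟧c y
      ⟦ ∃ᶜ R C ⟧c x = ∃ λ y → ⟦ R ⟧r x y × ⟦ C ⟧c y
      ⟦ nominal a ⟧c x = x ≡ ind 𝓘 a
      ⟦ atLeast n R C ⟧c x = AtLeast n ⟦ R ⟧b ⟦ C ⟧c x
      ⟦ atMost n R C ⟧c x = ¬ AtLeast (suc n) ⟦ R ⟧b ⟦ C ⟧c x
      ⟦ selfᶜ r ⟧c x = role 𝓘 r x x

    IsModel : TBox → Set
    IsModel 𝓣 = All (λ { (C , C') → ∀ x → ⟦ C ⟧c x → ⟦ C' ⟧c x }) 𝓣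

    UnreachableObjectsFree : Set
    UnreachableObjectsFree =
      ∀ x → ∃ λ a → Star (λ y z → ∃ λ (R : BasicRole) → ⟦ R ⟧b y z) (ind 𝓘 a) x

-- Z restricts to a bijection between {y | R x y} and {y' | R' x' y'}:
-- f is defined on the successors, independent of the witness of R x y,
-- injective, surjective onto the R'-successors of x', and contained in Z.
record RelBij {A B : Set} (Z : A → B → Set)
              (R : A → A → Set) (R' : B → B → Set) (x : A) (x' : B) : Set where
  field
    f      : ∀ y → R x y → B
    f-succ : ∀ y (p : R x y) → R' x' (f y p)
    f-Z    : ∀ y (p : R x y) → Z y (f y p)
    f-inj  : ∀ y z (p : R x y) (q : R x z) → f y p ≡ f z q → y ≡ z
    f-wd   : ∀ y (p q : R x y) → f y p ≡ f y q
    f-surj : ∀ y' → R' x' y' → ∃ λ y → Σ (R x y) λ p → f y p ≡ y'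

flip : {A : Set} → (A → A → Set) → A → A → Set
flip R x y = R y x

record Bisimulation (S : Signature) (Φ : Features) (𝓘 𝓘' : Interp S)
                    (Z : Δ 𝓘 → Δ 𝓘' → Set) : Set where
  field
    B1 : ∀ a → Z (ind 𝓘 a) (ind 𝓘' a)
    B2 : ∀ A x x' → Z x x' → (conc 𝓘 A x → conc 𝓘' A x') × (conc 𝓘' A x' → conc 𝓘 A x)
    B3 : ∀ r x x' y → Z x x' → role 𝓘 r x y → ∃ λ y' → Z y y' × role 𝓘' r x' y'
    B4 : ∀ r x x' y' → Z x x' → role 𝓘' r x' y' → ∃ λ y → Z y y' × role 𝓘 r x y
    B5 : T (hasI Φ) → ∀ r x x' y → Z x x' → role 𝓘 r y x → ∃ λ y' → Z y y' × role 𝓘' r y' x'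
    B6 : T (hasI Φ) → ∀ r x x' y' → Z x x' → role 𝓘' r y' x' → ∃ λ y → Z y y' × role 𝓘 r y x
    B7 : T (hasO Φ) → ∀ a x x' → Z x x' → (x ≡ ind 𝓘 a → x' ≡ ind 𝓘' a) × (x' ≡ ind 𝓘' a → x ≡ ind 𝓘 a)
    B8 : T (hasQ Φ) → ∀ r x x' → Z x x' → RelBij Z (role 𝓘 r) (role 𝓘' r) x x'
    B9 : T (hasQ Φ) → T (hasI Φ) → ∀ r x x' → Z x x' →
         RelBij Z (flip (role 𝓘 r)) (flip (role 𝓘' r)) x x'
    B10 : T (hasU Φ) → ∀ x → ∃ λ x' → Z x x'
    B11 : T (hasU Φ) → ∀ x' → ∃ λ x → Z x x'
    B12 : T (hasSelf Φ) → ∀ r x x' → Z x x' → (role 𝓘 r x x → role 𝓘' r x' x') × (role 𝓘' r x' x' → role 𝓘 r x x)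

module Submission where

-- The central fact is that every concept C of L_Φ is preserved forward along
-- an L_Φ-bisimulation Z: Z x x' and x ∈ Cᴵ give x' ∈ Cᴵ'.  No
-- separate "backward" statement is needed, since the converse relation of a
-- bisimulation is again a bisimulation (the only non-trivial part is that the
-- inverse of the bijection required by (B8)/(B9) is again such a bijection).
-- Preservation is then proved by induction on concepts and roles, where the
-- negation and ≤-restriction cases invoke the induction hypothesis for the
-- converse bisimulation.  Roles are handled through the notion of a
-- "forth" simulation of one binary relation by another, which is closed under
-- composition, union and reflexive-transitive closure.
--
-- Finally, unreachable-objects-freeness guarantees that Z covers the whole
-- domain: every element lies on a basic-role path from a named individual,
-- and (B1) together with the forth conditions transport that path.  With
-- a Z-partner for every element, each axiom C ⊑ D transfers between I and I'.

open import Defs hiding (flip)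
open import Data.Bool using (T)
open import Data.Product using (∃; _×_; _,_; proj₁; proj₂; swap)
open import Data.Sum using (_⊎_; inj₁; inj₂)
open import Data.Unit using (⊤; tt)
open import Data.List using ([]; _∷_)
open import Data.List.Relation.Unary.All using ([]; _∷_)
open import Function using (flip)
open import Function.Bundles using (_⇔_; mk⇔)
open import Relation.Binary.PropositionalEquality
  using (_≡_; refl; sym; trans; subst)
open import Relation.Binary.Construct.Closure.ReflexiveTransitive
  using (Star; ε; _◅_; reverse)

record Forth {A B : Set} (Z : A → B → Set) (R : A → A → Set) (R' : B → B → Set) : Set where
  field
    simulate : ∀ {x x' y} → Z x x' → R x y → ∃ λ y' → Z y y' × R' x' y'
open Forth

_⨾_ : {A : Set} → (A → A → Set) → (A → A → Set) → A → A → Set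
(R ⨾ S) x y = ∃ λ w → R x w × S w y

module _ {A B : Set} {Z : A → B → Set} where

  forth-⨾ : {R S : A → A → Set} {R' S' : B → B → Set} →
            Forth Z R R' → Forth Z S S' → Forth Z (R ⨾ S) (R' ⨾ S')
  forth-⨾ simR simS .simulate z (w , r , s) with simulate simR z r
  ... | w' , zw , r' with simulate simS zw s
  ... | y' , zy , s' = y' , zy , (w' , r' , s')

  forth-⊎ : {R S : A → A → Set} {R' S' : B → B → Set} →
            Forth Z R R' → Forth Z S S' →
            Forth Z (λ x y → R x y ⊎ S x y) (λ x y → R' x y ⊎ S' x y)
  forth-⊎ simR simS .simulate z (inj₁ r) with simulate simR z r
  ... | y' , zy , r' = y' , zy , inj₁ r'
  forth-⊎ simR simS .simulate z (inj₂ s) with simulate simS z s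
  ... | y' , zy , s' = y' , zy , inj₂ s'

  forth-star : {R : A → A → Set} {R' : B → B → Set} →
               Forth Z R R' → Forth Z (Star R) (Star R')
  forth-star sim .simulate z ε = _ , z , ε
  forth-star sim .simulate z (r ◅ rs) with simulate sim z r
  ... | w' , zw , r' with simulate (forth-star sim) zw rs
  ... | y' , zy , rs' = y' , zy , (r' ◅ rs')

  -- Simulating predecessors: the converse of a composition is the reversed
  -- composition of converses, and the converse of a path is a reversed path.
  forth-flip-⨾ : {R S : A → A → Set} {R' S' : B → B → Set} →
                 Forth Z (flip R) (flip R') → Forth Z (flip S) (flip S') →
                 Forth Z (flip (R ⨾ S)) (flip (R' ⨾ S'))
  forth-flip-⨾ simR simS .simulate z (w , r , s) with simulate simS z s
  ... | w' , zw , s' with simulate simR zw r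
  ... | y' , zy , r' = y' , zy , (w' , r' , s')

  forth-flip-star : {R : A → A → Set} {R' : B → B → Set} →
                    Forth Z (flip R) (flip R') → Forth Z (flip (Star R)) (flip (Star R'))
  forth-flip-star sim .simulate z rs
    with simulate (forth-star sim) z (reverse (λ r → r) rs)
  ... | y' , zy , rs' = y' , zy , reverse (λ r → r) rs'

  forth-total : (∀ y → ∃ λ y' → Z y y') →
                Forth Z (λ _ _ → ⊤) (λ _ _ → ⊤)
  forth-total total .simulate z _ = proj₁ (total _) , proj₂ (total _) , tt

relBij-inverse : {A B : Set} {Z : A → B → Set} {R : A → A → Set} {R' : B → B → Set}
                 {x : A} {x' : B} →
                 RelBij Z R R' x x' → RelBij (flip Z) R' R x' x
relBij-inverse {A} {Z = Z} {R} {R'} {x} {x'} bij = record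
  { f      = g
  ; f-succ = g-succ
  ; f-Z    = λ y' p' → subst (Z (g y' p')) (f-g y' p') (f-Z _ (g-succ y' p'))
  ; f-inj  = g-inj
  ; f-wd   = λ y' p' q' → f-inj _ _ _ _ (trans (f-g y' p') (sym (f-g y' q')))
  ; f-surj = λ y p → f y p , f-succ y p , f-inj _ _ _ _ (f-g _ (f-succ y p))
  }
  where
    open RelBij bij

    g : ∀ y' → R' x' y' → A
    g y' p' = proj₁ (f-surj y' p')

    g-succ : ∀ y' (p' : R' x' y') → R x (g y' p')
    g-succ y' p' = proj₁ (proj₂ (f-surj y' p'))

    f-g : ∀ y' (p' : R' x' y') → f (g y' p') (g-succ y' p') ≡ y'
    f-g y' p' = proj₂ (proj₂ (f-surj y' p'))

    f-resp : ∀ {y z} (p : R x y) (q : R x z) → y ≡ z → f y p ≡ f z q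
    f-resp p q refl = f-wd _ p q

    g-inj : ∀ y' z' (p' : R' x' y') (q' : R' x' z') → g y' p' ≡ g z' q' → y' ≡ z'
    g-inj y' z' p' q' e =
      trans (sym (f-g y' p')) (trans (f-resp _ _ e) (f-g z' q'))

module _ {S : Signature} {Φ : Features} where

  converse : {𝓘 𝓘' : Interp S} {Z : Δ 𝓘 → Δ 𝓘' → Set} →
             Bisimulation S Φ 𝓘 𝓘' Z → Bisimulation S Φ 𝓘' 𝓘 (flip Z)
  converse bis = record
    { B1  = B1
    ; B2  = λ A x' x z → swap (B2 A x x' z)
    ; B3  = λ r x' x y' z → B4 r x x' y' z
    ; B4  = λ r x' x y z → B3 r x x' y z
    ; B5  = λ i r x' x y' z → B6 i r x x' y' z
    ; B6  = λ i r x' x y z → B5 i r x x' y z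
    ; B7  = λ o a x' x z → swap (B7 o a x x' z)
    ; B8  = λ q r x' x z → relBij-inverse (B8 q r x x' z)
    ; B9  = λ q i r x' x z → relBij-inverse (B9 q i r x x' z)
    ; B10 = B11
    ; B11 = B10
    ; B12 = λ s r x' x z → swap (B12 s r x x' z)
    }
    where open Bisimulation bis

  BasicStep : (𝓙 : Interp S) → Δ 𝓙 → Δ 𝓙 → Set
  BasicStep 𝓙 y w = ∃ λ (R : BasicRole S Φ) → ⟦_⟧b S Φ 𝓙 R y w

  module _ {𝓘 𝓘' : Interp S} {Z : Δ 𝓘 → Δ 𝓘' → Set} where

    atLeast-forth : ∀ {n R R' C C' x x'} → RelBij Z R R' x x' →
                    (∀ {y y'} → Z y y' → C y → C' y') →
                    AtLeast S Φ 𝓘 n R C x → AtLeast S Φ 𝓘' n R' C' x'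
    atLeast-forth bij C⇒C' (ys , ys-inj , ys-ok) =
      (λ i → f (ys i) (proj₁ (ys-ok i))) ,
      (λ i j e → ys-inj i j (f-inj _ _ _ _ e)) ,
      (λ i → f-succ _ _ , C⇒C' (f-Z _ _) (proj₂ (ys-ok i)))
      where open RelBij bij

    basicRole-bij : Bisimulation S Φ 𝓘 𝓘' Z → T (hasQ Φ) →
                    ∀ R {x x'} → Z x x' →
                    RelBij Z (⟦_⟧b S Φ 𝓘 R) (⟦_⟧b S Φ 𝓘' R) x x'
    basicRole-bij bis q (bname r)   z = Bisimulation.B8 bis q r _ _ z
    basicRole-bij bis q (binv i r)  z = Bisimulation.B9 bis q i r _ _ z

    basicStep-forth : Bisimulation S Φ 𝓘 𝓘' Z → Forth Z (BasicStep 𝓘) (BasicStep 𝓘')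
    basicStep-forth bis .simulate z (bname r , p) with Bisimulation.B3 bis r _ _ _ z p
    ... | y' , zy , p' = y' , zy , (bname r , p')
    basicStep-forth bis .simulate z (binv i r , p) with Bisimulation.B5 bis i r _ _ _ z p
    ... | y' , zy , p' = y' , zy , (binv i r , p')

  -- The cases whose semantics involve a negative occurrence
  -- (¬ C, ≤ n R.C) use the converse bisimulation.
  mutual
    concept-forth : {𝓘 𝓘' : Interp S} {Z : Δ 𝓘 → Δ 𝓘' → Set} →
                    Bisimulation S Φ 𝓘 𝓘' Z → ∀ C {x x'} → Z x x' →
                    ⟦_⟧c S Φ 𝓘 C x → ⟦_⟧c S Φ 𝓘' C x'
    concept-forth bis (cname A) z c = proj₁ (Bisimulation.B2 bis A _ _ z) c
    concept-forth bis ⊤ᶜ z c = tt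
    concept-forth bis (¬ᶜ C) z ¬c c' = ¬c (concept-forth (converse bis) C z c')
    concept-forth bis (C ⊓ D) z (c , d) =
      concept-forth bis C z c , concept-forth bis D z d
    concept-forth bis (C ⊔ D) z (inj₁ c) = inj₁ (concept-forth bis C z c)
    concept-forth bis (C ⊔ D) z (inj₂ d) = inj₂ (concept-forth bis D z d)
    concept-forth bis (∀ᶜ R C) z c y' r' with simulate (role-forth (converse bis) R) z r'
    ... | y , zy , r = concept-forth bis C zy (c y r)
    concept-forth bis (∃ᶜ R C) z (y , r , c) with simulate (role-forth bis R) z r
    ... | y' , zy , r' = y' , r' , concept-forth bis C zy c
    concept-forth bis (nominal {{o}} a) z c =
      proj₁ (Bisimulation.B7 bis o a _ _ z) c
    -- AtLeast mentions the interpretation only through its domain, so the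
    -- interpretations are passed to atLeast-forth explicitly.
    concept-forth {𝓘} {𝓘'} bis (atLeast {{q}} n R C) z c =
      atLeast-forth {𝓘} {𝓘'} (basicRole-bij bis q R z) (concept-forth bis C) c
    concept-forth {𝓘} {𝓘'} bis (atMost {{q}} n R C) z ¬c c' =
      ¬c (atLeast-forth {𝓘'} {𝓘} (basicRole-bij (converse bis) q R z)
                        (concept-forth (converse bis) C) c')
    concept-forth bis (selfᶜ {{s}} r) z c =
      proj₁ (Bisimulation.B12 bis s r _ _ z) c

    role-forth : {𝓘 𝓘' : Interp S} {Z : Δ 𝓘 → Δ 𝓘' → Set} →
                 Bisimulation S Φ 𝓘 𝓘' Z → ∀ R →
                 Forth Z (⟦_⟧r S Φ 𝓘 R) (⟦_⟧r S Φ 𝓘' R)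
    role-forth bis (rname r) .simulate z p = Bisimulation.B3 bis r _ _ _ z p
    role-forth bis ε .simulate z refl = _ , z , refl
    role-forth bis (R ∘ʳ R') = forth-⨾ (role-forth bis R) (role-forth bis R')
    role-forth bis (R ⊔ʳ R') = forth-⊎ (role-forth bis R) (role-forth bis R')
    role-forth bis (R *ʳ) = forth-star (role-forth bis R)
    role-forth bis (C ¿) .simulate z (refl , c) = _ , z , refl , concept-forth bis C z c
    role-forth bis (_⁻ {{i}} R) = inverse-forth bis i R
    role-forth bis (U {{u}}) = forth-total (Bisimulation.B10 bis u)

    inverse-forth : {𝓘 𝓘' : Interp S} {Z : Δ 𝓘 → Δ 𝓘' → Set} →
                    Bisimulation S Φ 𝓘 𝓘' Z → T (hasI Φ) → ∀ R →
                    Forth Z (flip (⟦_⟧r S Φ 𝓘 R)) (flip (⟦_⟧r S Φ 𝓘' R))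
    inverse-forth bis i (rname r) .simulate z p = Bisimulation.B5 bis i r _ _ _ z p
    inverse-forth bis i ε .simulate z refl = _ , z , refl
    inverse-forth bis i (R ∘ʳ R') =
      forth-flip-⨾ (inverse-forth bis i R) (inverse-forth bis i R')
    inverse-forth bis i (R ⊔ʳ R') =
      forth-⊎ (inverse-forth bis i R) (inverse-forth bis i R')
    inverse-forth bis i (R *ʳ) =
      forth-flip-star (inverse-forth bis i R)
    inverse-forth bis i (C ¿) .simulate z (refl , c) = _ , z , refl , concept-forth bis C z c
    inverse-forth bis i (R ⁻) = role-forth bis R
    inverse-forth bis i (U {{u}}) = forth-total (Bisimulation.B10 bis u)

  module _ {𝓘 𝓘' : Interp S} {Z : Δ 𝓘 → Δ 𝓘' → Set} (bis : Bisimulation S Φ 𝓘 𝓘' Z) where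

    -- In an unreachable-objects-free interpretation every element has a
    -- Z-partner: transport its basic-role path from a named individual a,
    -- starting at the (B1)-related pair (aᴵ, aᴵ').
    partner : UnreachableObjectsFree S Φ 𝓘 → ∀ x → ∃ λ x' → Z x x'
    partner uof x with uof x
    ... | a , path
      with simulate (forth-star (basicStep-forth bis)) (Bisimulation.B1 bis a) path
    ... | x' , z , _ = x' , z

    -- If every element of 𝓘' has a Z-partner, each axiom valid in 𝓘 is valid
    -- in 𝓘': move x' ∈ Cᴵ' back to its partner, apply the axiom, move forth.
    model-transfer : (∀ x' → ∃ λ x → Z x x') →
                     (𝓣 : TBox S Φ) → IsModel S Φ 𝓘 𝓣 → IsModel S Φ 𝓘' 𝓣
    model-transfer covered [] [] = []
    model-transfer covered ((C , D) ∷ 𝓣) (C⊑D ∷ model) =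
      axiom ∷ model-transfer covered 𝓣 model
      where
        axiom : ∀ x' → ⟦_⟧c S Φ 𝓘' C x' → ⟦_⟧c S Φ 𝓘' D x'
        axiom x' c' with covered x'
        ... | x , z =
          concept-forth bis D z (C⊑D x (concept-forth (converse bis) C z c'))

-- Z-partners exist on both sides by unreachable-objects-freeness (for 𝓘'
-- via the converse bisimulation), so models transfer in both directions.
theorem2 : (S : Signature) (Φ : Features) (𝓣 : TBox S Φ) (𝓘 𝓘' : Interp S) →
    UnreachableObjectsFree S Φ 𝓘 → UnreachableObjectsFree S Φ 𝓘' →
    ∃ (Bisimulation S Φ 𝓘 𝓘') →
    IsModel S Φ 𝓘 𝓣 ⇔ IsModel S Φ 𝓘' 𝓣
theorem2 S Φ 𝓣 𝓘 𝓘' uof uof' (Z , bis) =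
  mk⇔ (model-transfer bis (partner (converse bis) uof') 𝓣)
      (model-transfer (converse bis) (partner bis uof) 𝓣)
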